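{- If $H$ is a bipartite graph having Sidorenko's property, then $K_2\,\square\,H$ has Sidorenko's property.
   Context: All graphs are finite and simple. $t_H(G)=|\mathrm{Hom}(H,G)|/|V(G)|^{|V(H)|}$, where $\mathrm{Hom}(H,G)$ is the set of graph homomorphisms from $H$ to $G$. A bipartite graph $H$ has Sidorenko's property if $t_H(G)\ge t_{K_2}(G)^{|E(H)|}$ for all graphs $G$. The Cartesian product $H_1\,\square\,H_2$ is the graph on $V(H_1)\times V(H_2)$ in which $(u_1,u_2)$ and $(v_1,v_2)$ are adjacent iff either $u_1v_1\in E(H_1)$ and $u_2=v_2$, or $u_2v_2\in E(H_2)$ and $u_1=v_1$. -}

module Defs where

open import Data.Bool using (Bool; true; false; _∧_; _∨_; not; if_then_else_)
open import Data.Nat using (ℕ; zero; suc; _+_; _*_; _^_; _≤_; _<ᵇ_)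
open import Data.Fin using (Fin; toℕ; combine; remQuot; _≟_)
open import Data.List using (List; map; allFin)
open import Data.Nat.ListAction using (sum)
open import Data.Bool.ListAction using (and)
open import Data.Bool.Properties using (∧-zeroʳ)
open import Data.Product using (Σ; _,_; proj₁; proj₂)
open import Data.Vec.Functional using (_∷_)
open import Relation.Nullary using (does; yes; no; ¬_)
open import Relation.Binary.PropositionalEquality using (_≡_; refl; sym; cong₂)

record Graph : Set where
  field
    n      : ℕ
    adj    : Fin n → Fin n → Bool
    adjSym : ∀ i j → adj i j ≡ adj j i
    adjIrr : ∀ i → adj i i ≡ false
open Graph public

∣V∣ : Graph → ℕ
∣V∣ H = n H

∣E∣ : Graph → ℕ
∣E∣ H = sum (map (λ i → sum (map (λ j → if adj H i j ∧ (toℕ i <ᵇ toℕ j) then 1 else 0)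
                                  (allFin (n H))))
                 (allFin (n H)))

isHom : (H G : Graph) → (Fin (n H) → Fin (n G)) → Bool
isHom H G f = and (map (λ i → and (map (λ j → not (adj H i j) ∨ adj G (f i) (f j))
                                       (allFin (n H))))
                       (allFin (n H)))

countFun : (k m : ℕ) → ((Fin k → Fin m) → Bool) → ℕ
countFun zero    m P = if P (λ ()) then 1 else 0
countFun (suc k) m P = sum (map (λ a → countFun k m (λ g → P (a ∷ g))) (allFin m))

hom : Graph → Graph → ℕ
hom H G = countFun (n H) (n G) (isHom H G)

IsBipartite : Graph → Set
IsBipartite H = Σ (Fin (n H) → Bool) λ c → ∀ i j → adj H i j ≡ true → ¬ (c i ≡ c j)

K₂ : Graph
K₂ = record { n = 2 ; adj = a ; adjSym = s ; adjIrr = r }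
  where
  a : Fin 2 → Fin 2 → Bool
  a Fin.zero Fin.zero = false
  a Fin.zero (Fin.suc Fin.zero) = true
  a (Fin.suc Fin.zero) Fin.zero = true
  a (Fin.suc Fin.zero) (Fin.suc Fin.zero) = false
  s : ∀ i j → a i j ≡ a j i
  s Fin.zero Fin.zero = refl
  s Fin.zero (Fin.suc Fin.zero) = refl
  s (Fin.suc Fin.zero) Fin.zero = refl
  s (Fin.suc Fin.zero) (Fin.suc Fin.zero) = refl
  r : ∀ i → a i i ≡ false
  r Fin.zero = refl
  r (Fin.suc Fin.zero) = refl

eqᵇ : ∀ {m} → Fin m → Fin m → Bool
eqᵇ a b = does (a ≟ b)

eqᵇ-sym : ∀ {m} (a b : Fin m) → eqᵇ a b ≡ eqᵇ b a
eqᵇ-sym a b with a ≟ b | b ≟ a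
... | yes _ | yes _ = refl
... | no _  | no _  = refl
... | yes p | no q  = Data.Empty.⊥-elim (q (sym p))
  where import Data.Empty
... | no p  | yes q = Data.Empty.⊥-elim (p (sym q))
  where import Data.Empty

eqᵇ-refl : ∀ {m} (a : Fin m) → eqᵇ a a ≡ true
eqᵇ-refl a with a ≟ a
... | yes _ = refl
... | no p  = Data.Empty.⊥-elim (p refl)
  where import Data.Empty

-- Cartesian product G₁ □ G₂ on vertex set Fin (n₁ * n₂) ≅ Fin n₁ × Fin n₂
-- (identification via Data.Fin.combine / remQuot).
cartAdj : (G₁ G₂ : Graph) → Fin (n G₁) → Fin (n G₂) → Fin (n G₁) → Fin (n G₂) → Bool
cartAdj G₁ G₂ u₁ u₂ v₁ v₂ = (adj G₁ u₁ v₁ ∧ eqᵇ u₂ v₂) ∨ (eqᵇ u₁ v₁ ∧ adj G₂ u₂ v₂)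

pr₁ : (a b : ℕ) → Fin (a * b) → Fin a
pr₁ a b x = proj₁ (remQuot {a} b x)

pr₂ : (a b : ℕ) → Fin (a * b) → Fin b
pr₂ a b x = proj₂ (remQuot {a} b x)

cartSym : (G₁ G₂ : Graph) → ∀ u₁ u₂ v₁ v₂ → cartAdj G₁ G₂ u₁ u₂ v₁ v₂ ≡ cartAdj G₁ G₂ v₁ v₂ u₁ u₂
cartSym G₁ G₂ u₁ u₂ v₁ v₂
  rewrite adjSym G₁ u₁ v₁ | adjSym G₂ u₂ v₂ | eqᵇ-sym u₁ v₁ | eqᵇ-sym u₂ v₂ = refl

cartIrr : (G₁ G₂ : Graph) → ∀ u₁ u₂ → cartAdj G₁ G₂ u₁ u₂ u₁ u₂ ≡ false
cartIrr G₁ G₂ u₁ u₂ rewrite adjIrr G₁ u₁ | adjIrr G₂ u₂ | eqᵇ-refl u₁ = ∧-zeroʳ true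

_□_ : Graph → Graph → Graph
G₁ □ G₂ = record
  { n = n G₁ * n G₂
  ; adj = λ x y → cartAdj G₁ G₂ (p₁ x) (p₂ x) (p₁ y) (p₂ y)
  ; adjSym = λ x y → cartSym G₁ G₂ (p₁ x) (p₂ x) (p₁ y) (p₂ y)
  ; adjIrr = λ x → cartIrr G₁ G₂ (p₁ x) (p₂ x)
  }
  where
  p₁ = pr₁ (n G₁) (n G₂)
  p₂ = pr₂ (n G₁) (n G₂)

-- Sidorenko's property: t_H(G) ≥ t_{K₂}(G)^{|E(H)|} for all graphs G, i.e.
--   hom(H,G) / N^{|V(H)|} ≥ (hom(K₂,G) / N²)^{|E(H)|}   with N = |V(G)|,
-- stated with denominators cleared (N ≥ 1 imposed, t is undefined for N = 0).
Sidorenko : Graph → Set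
Sidorenko H = ∀ (G : Graph) → 1 ≤ n G →
  hom K₂ G ^ ∣E∣ H * n G ^ ∣V∣ H ≤ hom H G * n G ^ (2 * ∣E∣ H)

-- Let G have N vertices and D = hom(K₂,G) arcs (ordered adjacent pairs).
-- The ARC GRAPH G⁽²⁾ has the D arcs (a,b) of G as vertices, (a,b) ~ (a',b')
-- iff a ~ a' and b ~ b'.  A map V(K₂ □ H) → V(G) is a pair of maps
-- f₁, f₂ : V(H) → V(G) (the two copies of H); it is a homomorphism iff every
-- (f₁ i, f₂ i) is an arc and i ↦ (f₁ i, f₂ i) is a homomorphism H → G⁽²⁾, so
--   (1) hom(K₂ □ H, G) = hom(H, G⁽²⁾).
-- Moreover (2) |E(K₂ □ H)| = 2|E(H)| + |V(H)|, and hom(K₂, G⁽²⁾) counts closed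
-- 4-walks of G, so two applications of Cauchy–Schwarz give
--   (3) D⁴ ≤ N⁴ · hom(K₂, G⁽²⁾).
-- Sidorenko's property of H applied to G⁽²⁾, combined with (1)–(3), yields the
-- claim by exponent arithmetic.
module Submission where

open import Data.Bool using (Bool; true; false; _∧_; _∨_; not; if_then_else_; T)
open import Data.Bool.ListAction using (and)
open import Data.Bool.Properties using (∨-identityʳ)
open import Data.Empty using (⊥-elim)
open import Data.Fin using (Fin; zero; suc; toℕ; _↑ˡ_; _↑ʳ_; combine; remQuot; splitAt; _≟_)
open import Data.Fin.Properties using (remQuot-combine; combine-remQuot; splitAt-↑ˡ; splitAt-↑ʳ; toℕ-injective)
open import Data.List using (List; []; _∷_; map; _++_; length; allFin; lookup; filterᵇ; cartesianProduct)
open import Data.List.Properties using (map-cong; map-∘; map-++; map-tabulate; tabulate-lookup; length-tabulate)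
open import Data.Nat using (ℕ; zero; suc; _+_; _*_; _^_; _∸_; _≤_; _<_; _<ᵇ_; z≤n; s≤s)
open import Data.Nat.ListAction using (sum)
open import Data.Nat.ListAction.Properties using (sum-++)
open import Data.Nat.Properties hiding (_≟_)
open import Algebra.Properties.CommutativeSemigroup +-commutativeSemigroup using (interchange)
open import Algebra.Properties.CommutativeSemigroup *-commutativeSemigroup using () renaming (interchange to *-interchange)
open import Data.Nat.Tactic.RingSolver using (solve-∀)
open import Data.Product using (_×_; _,_; proj₁; proj₂)
open import Data.Sum using (inj₁; inj₂)
open import Data.Unit using (tt)
open import Data.Vec.Functional using () renaming (_∷_ to _∷ᶠ_; _++_ to _++ᶠ_)
open import Function using (_∘_; id)
open import Relation.Binary using (tri<; tri≈; tri>)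
open import Relation.Binary.PropositionalEquality
open import Relation.Nullary using (¬_; yes)
open import Defs

-- The Iverson bracket; countFun and ∣E∣ count with exactly this function.
𝟙 : Bool → ℕ
𝟙 b = if b then 1 else 0

𝟙-∧ : ∀ b c → 𝟙 (b ∧ c) ≡ 𝟙 b * 𝟙 c
𝟙-∧ true  c = sym (+-identityʳ (𝟙 c))
𝟙-∧ false c = refl

∑ : {A : Set} → List A → (A → ℕ) → ℕ
∑ xs f = sum (map f xs)

module _ {A : Set} where

  ∑-cong : ∀ xs {f g : A → ℕ} → (∀ x → f x ≡ g x) → ∑ xs f ≡ ∑ xs g
  ∑-cong xs f≗g = cong sum (map-cong f≗g xs)

  ∑-+ : ∀ xs (f g : A → ℕ) → ∑ xs (λ x → f x + g x) ≡ ∑ xs f + ∑ xs g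
  ∑-+ []       f g = refl
  ∑-+ (x ∷ xs) f g = begin
    f x + g x + ∑ xs (λ y → f y + g y) ≡⟨ cong (f x + g x +_) (∑-+ xs f g) ⟩
    f x + g x + (∑ xs f + ∑ xs g)      ≡⟨ interchange (f x) (g x) (∑ xs f) (∑ xs g) ⟩
    f x + ∑ xs f + (g x + ∑ xs g)      ∎
    where open ≡-Reasoning

  ∑-*ˡ : ∀ xs c (f : A → ℕ) → c * ∑ xs f ≡ ∑ xs (λ x → c * f x)
  ∑-*ˡ []       c f = *-zeroʳ c
  ∑-*ˡ (x ∷ xs) c f = trans (*-distribˡ-+ c (f x) (∑ xs f)) (cong (c * f x +_) (∑-*ˡ xs c f))

  ∑-*ʳ : ∀ xs c (f : A → ℕ) → ∑ xs f * c ≡ ∑ xs (λ x → f x * c)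
  ∑-*ʳ xs c f = begin
    ∑ xs f * c             ≡⟨ *-comm (∑ xs f) c ⟩
    c * ∑ xs f             ≡⟨ ∑-*ˡ xs c f ⟩
    ∑ xs (λ x → c * f x)   ≡⟨ ∑-cong xs (λ x → *-comm c (f x)) ⟩
    ∑ xs (λ x → f x * c)   ∎
    where open ≡-Reasoning

  ∑-zero : ∀ xs → ∑ xs (λ (_ : A) → 0) ≡ 0
  ∑-zero []       = refl
  ∑-zero (x ∷ xs) = ∑-zero xs

  ∑-one : ∀ xs → ∑ xs (λ (_ : A) → 1) ≡ length xs
  ∑-one []       = refl
  ∑-one (x ∷ xs) = cong suc (∑-one xs)

  ∑-++ : ∀ xs ys (f : A → ℕ) → ∑ (xs ++ ys) f ≡ ∑ xs f + ∑ ys f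
  ∑-++ xs ys f = trans (cong sum (map-++ f xs ys)) (sum-++ (map f xs) (map f ys))

  ∑-mono : ∀ xs {f g : A → ℕ} → (∀ x → f x ≤ g x) → ∑ xs f ≤ ∑ xs g
  ∑-mono []       f≤g = z≤n
  ∑-mono (x ∷ xs) f≤g = +-mono-≤ (f≤g x) (∑-mono xs f≤g)

  ∑-filter : ∀ (q : A → Bool) xs F → ∑ (filterᵇ q xs) F ≡ ∑ xs (λ a → 𝟙 (q a) * F a)
  ∑-filter q []       F = refl
  ∑-filter q (x ∷ xs) F with q x
  ... | true  = cong₂ _+_ (sym (+-identityʳ (F x))) (∑-filter q xs F)
  ... | false = ∑-filter q xs F

∑-map : {A B : Set} (xs : List A) (g : A → B) (f : B → ℕ) → ∑ (map g xs) f ≡ ∑ xs (f ∘ g)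
∑-map xs g f = cong sum (sym (map-∘ xs))

module _ {A B : Set} where

  ∑-swap : ∀ (xs : List A) (ys : List B) (F : A → B → ℕ) →
    ∑ xs (λ x → ∑ ys (F x)) ≡ ∑ ys (λ y → ∑ xs (λ x → F x y))
  ∑-swap []       ys F = sym (∑-zero ys)
  ∑-swap (x ∷ xs) ys F = begin
    ∑ ys (F x) + ∑ xs (λ x′ → ∑ ys (F x′))      ≡⟨ cong (∑ ys (F x) +_) (∑-swap xs ys F) ⟩
    ∑ ys (F x) + ∑ ys (λ y → ∑ xs (λ x′ → F x′ y)) ≡⟨ ∑-+ ys (F x) _ ⟨
    ∑ ys (λ y → F x y + ∑ xs (λ x′ → F x′ y))   ∎
    where open ≡-Reasoning

  ∑-product : ∀ (xs : List A) (ys : List B) (f : A → ℕ) (g : B → ℕ) →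
    ∑ xs f * ∑ ys g ≡ ∑ xs (λ x → ∑ ys (λ y → f x * g y))
  ∑-product xs ys f g = trans (∑-*ʳ xs (∑ ys g) f) (∑-cong xs (λ x → ∑-*ˡ ys (f x) g))

  ∑-cartesianProduct : ∀ (xs : List A) (ys : List B) F →
    ∑ (cartesianProduct xs ys) F ≡ ∑ xs (λ x → ∑ ys (λ y → F (x , y)))
  ∑-cartesianProduct []       ys F = refl
  ∑-cartesianProduct (x ∷ xs) ys F = trans (∑-++ (map (x ,_) ys) _ F)
    (cong₂ _+_ (∑-map ys (x ,_) F) (∑-cartesianProduct xs ys F))

-- AM–GM for a ≤ b: writing b = a + d, we have a² + b² = 2ab + d².
am-gm-≤ : ∀ {a b} → a ≤ b → 2 * a * b ≤ a * a + b * b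
am-gm-≤ {a} {b} a≤b = subst (λ c → 2 * a * c ≤ a * a + c * c) (m+[n∸m]≡n a≤b)
  (subst (2 * a * (a + (b ∸ a)) ≤_) (gap a (b ∸ a)) (m≤m+n _ _))
  where
  gap : ∀ a d → 2 * a * (a + d) + d * d ≡ a * a + (a + d) * (a + d)
  gap = solve-∀

am-gm : ∀ a b → 2 * a * b ≤ a * a + b * b
am-gm a b with ≤-total a b
... | inj₁ a≤b = am-gm-≤ a≤b
... | inj₂ b≤a = subst₂ _≤_ (swap b a) (+-comm (b * b) (a * a)) (am-gm-≤ b≤a)
  where
  swap : ∀ b a → 2 * b * a ≡ 2 * a * b
  swap = solve-∀

module _ {A : Set} where

  -- The cross term of (a + ∑ f)²: 2a·∑f ≤ ∑ f² + |xs|·a², by AM–GM termwise.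
  cross-term : ∀ a (xs : List A) f → 2 * a * ∑ xs f ≤ ∑ xs (λ x → f x * f x) + length xs * (a * a)
  cross-term a []       f = subst (_≤ 0) (sym (*-zeroʳ (2 * a))) z≤n
  cross-term a (y ∷ xs) f = subst₂ _≤_ (distrib a (f y) (∑ xs f)) (regroup (a * a) (f y * f y) _ (length xs))
      (+-mono-≤ (am-gm a (f y)) (cross-term a xs f))
    where
    distrib : ∀ a b c → 2 * a * b + 2 * a * c ≡ 2 * a * (b + c)
    distrib = solve-∀
    regroup : ∀ aa bb q n → aa + bb + (q + n * aa) ≡ bb + q + suc n * aa
    regroup = solve-∀

  cauchy-schwarz : ∀ (xs : List A) f → ∑ xs f * ∑ xs f ≤ length xs * ∑ xs (λ x → f x * f x)
  cauchy-schwarz []       f = z≤n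
  cauchy-schwarz (y ∷ xs) f = subst₂ _≤_ (square (f y) (∑ xs f)) (regroup (f y) _ (length xs))
      (+-mono-≤ (+-monoʳ-≤ (f y * f y) (cross-term (f y) xs f)) (cauchy-schwarz xs f))
    where
    square : ∀ a s → a * a + 2 * a * s + s * s ≡ (a + s) * (a + s)
    square = solve-∀
    regroup : ∀ a q n → a * a + (q + n * (a * a)) + n * q ≡ suc n * (a * a + q)
    regroup = solve-∀

∑Fin : ∀ m → (Fin m → ℕ) → ℕ
∑Fin m f = ∑ (allFin m) f

∑Fin-suc : ∀ m (f : Fin (suc m) → ℕ) → ∑Fin (suc m) f ≡ f zero + ∑Fin m (f ∘ suc)
∑Fin-suc m f = cong (λ xs → f zero + sum xs)
  (trans (map-tabulate suc f) (sym (map-tabulate id (f ∘ suc))))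

∑Fin-one : ∀ m → ∑Fin m (λ _ → 1) ≡ m
∑Fin-one m = trans (∑-one (allFin m)) (length-tabulate id)

∑Fin-δ : ∀ m (r : Fin m) → ∑Fin m (λ s → 𝟙 (eqᵇ r s)) ≡ 1
∑Fin-δ (suc m) zero    = trans (∑Fin-suc m (λ s → 𝟙 (eqᵇ zero s))) (cong suc (∑-zero (allFin m)))
∑Fin-δ (suc m) (suc r) = trans (∑Fin-suc m (λ s → 𝟙 (eqᵇ (suc r) s))) (∑Fin-δ m r)

∑Fin-↑ : ∀ m k (f : Fin (m + k) → ℕ) →
  ∑Fin (m + k) f ≡ ∑Fin m (λ i → f (i ↑ˡ k)) + ∑Fin k (λ j → f (m ↑ʳ j))
∑Fin-↑ zero    k f = refl
∑Fin-↑ (suc m) k f = begin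
  ∑Fin (suc m + k) f
    ≡⟨ ∑Fin-suc (m + k) f ⟩
  f zero + ∑Fin (m + k) (f ∘ suc)
    ≡⟨ cong (f zero +_) (∑Fin-↑ m k (f ∘ suc)) ⟩
  f zero + (∑Fin m (λ i → f (suc i ↑ˡ k)) + right)
    ≡⟨ +-assoc (f zero) _ _ ⟨
  f zero + ∑Fin m (λ i → f (suc i ↑ˡ k)) + right
    ≡⟨ cong (_+ right) (∑Fin-suc m (λ i → f (i ↑ˡ k))) ⟨
  ∑Fin (suc m) (λ i → f (i ↑ˡ k)) + right ∎
  where
  open ≡-Reasoning
  right : ℕ
  right = ∑Fin k (λ j → f (suc m ↑ʳ j))

∑Fin-combine : ∀ m k (f : Fin (m * k) → ℕ) →
  ∑Fin (m * k) f ≡ ∑Fin m (λ i → ∑Fin k (λ j → f (combine i j)))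
∑Fin-combine zero    k f = refl
∑Fin-combine (suc m) k f = begin
  ∑Fin (k + m * k) f
    ≡⟨ ∑Fin-↑ k (m * k) f ⟩
  first + ∑Fin (m * k) (λ x → f (k ↑ʳ x))
    ≡⟨ cong (first +_) (∑Fin-combine m k (λ x → f (k ↑ʳ x))) ⟩
  first + ∑Fin m (λ i → ∑Fin k (λ j → f (combine (suc i) j)))
    ≡⟨ ∑Fin-suc m _ ⟨
  ∑Fin (suc m) (λ i → ∑Fin k (λ j → f (combine i j))) ∎
  where
  open ≡-Reasoning
  first : ℕ
  first = ∑Fin k (λ j → f (j ↑ˡ m * k))

cauchy-schwarz-Fin : ∀ m (f : Fin m → ℕ) → ∑Fin m f * ∑Fin m f ≤ m * ∑Fin m (λ x → f x * f x)
cauchy-schwarz-Fin m f =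
  subst (λ l → ∑Fin m f * ∑Fin m f ≤ l * ∑Fin m (λ x → f x * f x)) (length-tabulate {n = m} id) (cauchy-schwarz (allFin m) f)

-- ∑Maps k xs w sums w g over all g : Fin k → A with values in xs,
-- enumerated one coordinate at a time, exactly as countFun enumerates maps.
∑Maps : {A : Set} (k : ℕ) → List A → ((Fin k → A) → ℕ) → ℕ
∑Maps zero    xs w = w (λ ())
∑Maps (suc k) xs w = ∑ xs (λ a → ∑Maps k xs (λ g → w (a ∷ᶠ g)))

-- A weight on maps that only depends on their values (maps are functions,
-- so this is not automatic without function extensionality).
Extensional : {A : Set} {k : ℕ} → ((Fin k → A) → ℕ) → Set
Extensional {k = k} w = ∀ f g → (∀ (i : Fin k) → f i ≡ g i) → w f ≡ w g

countFun≡∑Maps : ∀ k m P → countFun k m P ≡ ∑Maps k (allFin m) (λ f → 𝟙 (P f))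
countFun≡∑Maps zero    m P = refl
countFun≡∑Maps (suc k) m P = ∑-cong (allFin m) (λ a → countFun≡∑Maps k m _)

module _ {A : Set} where

  Extensional-∷ : ∀ {k} (w : (Fin (suc k) → A) → ℕ) → Extensional w → ∀ a → Extensional (λ g → w (a ∷ᶠ g))
  Extensional-∷ w ext a f g f≗g = ext _ _ λ { zero → refl ; (suc i) → f≗g i }

  ∑Maps-cong : ∀ k xs {w w′ : (Fin k → A) → ℕ} → (∀ f → w f ≡ w′ f) → ∑Maps k xs w ≡ ∑Maps k xs w′
  ∑Maps-cong zero    xs w≗w′ = w≗w′ _
  ∑Maps-cong (suc k) xs w≗w′ = ∑-cong xs (λ a → ∑Maps-cong k xs (λ g → w≗w′ (a ∷ᶠ g)))

  ∑Maps-+ : ∀ k xs (w w′ : (Fin k → A) → ℕ) → ∑Maps k xs (λ g → w g + w′ g) ≡ ∑Maps k xs w + ∑Maps k xs w′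
  ∑Maps-+ zero    xs w w′ = refl
  ∑Maps-+ (suc k) xs w w′ = trans (∑-cong xs (λ a → ∑Maps-+ k xs _ _)) (∑-+ xs _ _)

  ∑Maps-*ˡ : ∀ k xs c (w : (Fin k → A) → ℕ) → c * ∑Maps k xs w ≡ ∑Maps k xs (λ g → c * w g)
  ∑Maps-*ˡ zero    xs c w = refl
  ∑Maps-*ˡ (suc k) xs c w = trans (∑-*ˡ xs c _) (∑-cong xs (λ a → ∑Maps-*ˡ k xs c _))

  ∑Maps-zero : ∀ k xs → ∑Maps k xs (λ (_ : Fin k → A) → 0) ≡ 0
  ∑Maps-zero zero    xs = refl
  ∑Maps-zero (suc k) xs = trans (∑-cong xs (λ a → ∑Maps-zero k xs)) (∑-zero xs)

  ∑Maps-∑ : ∀ {B : Set} k xs (ys : List B) (F : B → (Fin k → A) → ℕ) →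
    ∑Maps k xs (λ g → ∑ ys (λ y → F y g)) ≡ ∑ ys (λ y → ∑Maps k xs (F y))
  ∑Maps-∑ k xs []       F = ∑Maps-zero k xs
  ∑Maps-∑ k xs (y ∷ ys) F = trans (∑Maps-+ k xs _ _) (cong (∑Maps k xs (F y) +_) (∑Maps-∑ k xs ys F))

  ∑Maps-++ : ∀ k l xs (w : (Fin (k + l) → A) → ℕ) → Extensional w →
    ∑Maps (k + l) xs w ≡ ∑Maps k xs (λ f → ∑Maps l xs (λ g → w (f ++ᶠ g)))
  ∑Maps-++ zero    l xs w ext = ∑Maps-cong l xs (λ g → ext _ _ (λ i → refl))
  ∑Maps-++ (suc k) l xs w ext =
    ∑-cong xs (λ a → trans (∑Maps-++ k l xs _ (Extensional-∷ w ext a))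
      (∑Maps-cong k xs (λ f → ∑Maps-cong l xs (λ g → ext _ _ (∷-++ a f g)))))
    where
    ∷-++ : ∀ {k l} (a : A) (f : Fin k → A) (g : Fin l → A) → ∀ i → (a ∷ᶠ (f ++ᶠ g)) i ≡ ((a ∷ᶠ f) ++ᶠ g) i
    ∷-++ a f g zero = refl
    ∷-++ {k} a f g (suc i) with splitAt k i
    ... | inj₁ j = refl
    ... | inj₂ j = refl

  ++ᶠ-congʳ : ∀ {k l} (f : Fin k → A) (g g′ : Fin l → A) → (∀ i → g i ≡ g′ i) → ∀ i → (f ++ᶠ g) i ≡ (f ++ᶠ g′) i
  ++ᶠ-congʳ {k} f g g′ g≗g′ i with splitAt k i
  ... | inj₁ j = refl
  ... | inj₂ j = g≗g′ j

∑Maps-map : {A B : Set} → ∀ k (xs : List A) (h : A → B) (w : (Fin k → B) → ℕ) → Extensional w →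
  ∑Maps k (map h xs) w ≡ ∑Maps k xs (λ g → w (h ∘ g))
∑Maps-map zero    xs h w ext = ext _ _ (λ ())
∑Maps-map (suc k) xs h w ext = trans (∑-map xs h _)
  (∑-cong xs (λ a → trans (∑Maps-map k xs h _ (Extensional-∷ w ext (h a)))
    (∑Maps-cong k xs (λ g → ext _ _ (λ { zero → refl ; (suc i) → refl })))))

∑Maps-cartesianProduct : {A B : Set} → ∀ k (xs : List A) (ys : List B) (w : (Fin k → A × B) → ℕ) → Extensional w →
  ∑Maps k (cartesianProduct xs ys) w ≡ ∑Maps k xs (λ g₁ → ∑Maps k ys (λ g₂ → w (λ i → g₁ i , g₂ i)))
∑Maps-cartesianProduct zero    xs ys w ext = ext _ _ (λ ())
∑Maps-cartesianProduct (suc k) xs ys w ext =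
  trans (∑-cartesianProduct xs ys _)
  (∑-cong xs (λ x → trans
    (∑-cong ys (λ y → ∑Maps-cartesianProduct k xs ys _ (Extensional-∷ w ext (x , y))))
    (trans (sym (∑Maps-∑ k xs ys _))
      (∑Maps-cong k xs (λ g₁ → ∑-cong ys (λ y → ∑Maps-cong k ys (λ g₂ →
        ext _ _ (λ { zero → refl ; (suc i) → refl }))))))))

∧-elim : ∀ {b c} → b ∧ c ≡ true → (b ≡ true) × (c ≡ true)
∧-elim {true} {true} _ = refl , refl

∧-intro : ∀ {b c} → b ≡ true → c ≡ true → b ∧ c ≡ true
∧-intro refl refl = refl

≡-by-truth : ∀ {b c} → (b ≡ true → c ≡ true) → (c ≡ true → b ≡ true) → b ≡ c
≡-by-truth {true}  {true}  _ _ = refl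
≡-by-truth {true}  {false} b⇒c _ = sym (b⇒c refl)
≡-by-truth {false} {true}  _ c⇒b = c⇒b refl
≡-by-truth {false} {false} _ _ = refl

eqᵇ-true : ∀ {m} (r s : Fin m) → eqᵇ r s ≡ true → r ≡ s
eqᵇ-true r s _ with r ≟ s
... | yes r≡s = r≡s

allᵇ : ∀ k → (Fin k → Bool) → Bool
allᵇ k p = and (map p (allFin k))

allᵇ-suc : ∀ k (p : Fin (suc k) → Bool) → allᵇ (suc k) p ≡ p zero ∧ allᵇ k (p ∘ suc)
allᵇ-suc k p = cong (λ bs → p zero ∧ and bs)
  (trans (map-tabulate suc p) (sym (map-tabulate id (p ∘ suc))))

allᵇ-cong : ∀ k {p q : Fin k → Bool} → (∀ i → p i ≡ q i) → allᵇ k p ≡ allᵇ k q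
allᵇ-cong k p≗q = cong and (map-cong p≗q (allFin k))

allᵇ-elim : ∀ k (p : Fin k → Bool) → allᵇ k p ≡ true → ∀ i → p i ≡ true
allᵇ-elim (suc k) p all zero    = proj₁ (∧-elim (trans (sym (allᵇ-suc k p)) all))
allᵇ-elim (suc k) p all (suc i) = allᵇ-elim k (p ∘ suc) (proj₂ (∧-elim (trans (sym (allᵇ-suc k p)) all))) i

allᵇ-intro : ∀ k (p : Fin k → Bool) → (∀ i → p i ≡ true) → allᵇ k p ≡ true
allᵇ-intro zero    p _ = refl
allᵇ-intro (suc k) p h = trans (allᵇ-suc k p) (∧-intro (h zero) (allᵇ-intro k (p ∘ suc) (h ∘ suc)))

module _ {A : Set} where

  ∑Maps-filter : ∀ k (q : A → Bool) xs (w : (Fin k → A) → ℕ) →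
    ∑Maps k (filterᵇ q xs) w ≡ ∑Maps k xs (λ g → 𝟙 (allᵇ k (q ∘ g)) * w g)
  ∑Maps-filter zero    q xs w = sym (+-identityʳ _)
  ∑Maps-filter (suc k) q xs w =
    trans (∑-filter q xs _)
    (∑-cong xs (λ a → trans (cong (𝟙 (q a) *_) (∑Maps-filter k q xs _))
      (trans (∑Maps-*ˡ k xs (𝟙 (q a)) _)
        (∑Maps-cong k xs (λ g → trans (sym (*-assoc (𝟙 (q a)) _ _))
          (cong (_* w (a ∷ᶠ g)) (trans (sym (𝟙-∧ (q a) _)) (cong 𝟙 (sym (allᵇ-suc k (q ∘ (a ∷ᶠ g))))))))))))

-- isHomᴿ k R S g: g sends every R-related pair to an S-related pair.
-- isHom F G f is definitionally isHomᴿ (n F) (adj F) (adj G) f.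
isHomᴿ : {B : Set} → ∀ k → (Fin k → Fin k → Bool) → (B → B → Bool) → (Fin k → B) → Bool
isHomᴿ k R S g = allᵇ k (λ i → allᵇ k (λ j → not (R i j) ∨ S (g i) (g j)))

module _ {B : Set} where

  isHomᴿ-elim : ∀ k R (S : B → B → Bool) g → isHomᴿ k R S g ≡ true →
    ∀ i j → R i j ≡ true → S (g i) (g j) ≡ true
  isHomᴿ-elim k R S g hom i j Rij with allᵇ-elim k _ (allᵇ-elim k _ hom i) j
  ... | h rewrite Rij = h

  isHomᴿ-intro : ∀ k R (S : B → B → Bool) g → (∀ i j → R i j ≡ true → S (g i) (g j) ≡ true) →
    isHomᴿ k R S g ≡ true
  isHomᴿ-intro k R S g h = allᵇ-intro k _ (λ i → allᵇ-intro k _ (λ j → edge i j (R i j) refl))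
    where
    edge : ∀ i j b → R i j ≡ b → not b ∨ S (g i) (g j) ≡ true
    edge i j true  Rij = h i j Rij
    edge i j false _   = refl

  isHomᴿ-cong : ∀ k R (S : B → B → Bool) g g′ → (∀ i → g i ≡ g′ i) → isHomᴿ k R S g ≡ isHomᴿ k R S g′
  isHomᴿ-cong k R S g g′ g≗g′ =
    allᵇ-cong k (λ i → allᵇ-cong k (λ j → cong₂ (λ x y → not (R i j) ∨ S x y) (g≗g′ i) (g≗g′ j)))

□-adj-combine : ∀ G₁ G₂ a r b s →
  adj (G₁ □ G₂) (combine a r) (combine b s) ≡ cartAdj G₁ G₂ a r b s
□-adj-combine G₁ G₂ a r b s = cong₂ (λ p q → cartAdj G₁ G₂ (proj₁ p) (proj₂ p) (proj₁ q) (proj₂ q))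
  (remQuot-combine {n G₁} {n G₂} a r) (remQuot-combine {n G₁} {n G₂} b s)

arcCount : Graph → ℕ
arcCount F = ∑Fin (n F) (λ i → ∑Fin (n F) (λ j → 𝟙 (adj F i j)))

<ᵇ-true : ∀ {m n} → m < n → (m <ᵇ n) ≡ true
<ᵇ-true {m} {n} m<n with m <ᵇ n in eq
... | true  = refl
... | false = ⊥-elim (subst T eq (<⇒<ᵇ m<n))

<ᵇ-false : ∀ {m n} → ¬ (m < n) → (m <ᵇ n) ≡ false
<ᵇ-false {m} {n} m≮n with m <ᵇ n in eq
... | false = refl
... | true  = ⊥-elim (m≮n (<ᵇ⇒< m n (subst T (sym eq) tt)))

-- Each arc i → j is counted by ∣E∣ exactly once, as (i, j) or as (j, i).
orientations : ∀ F i j →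
  𝟙 (adj F i j) ≡ 𝟙 (adj F i j ∧ (toℕ i <ᵇ toℕ j)) + 𝟙 (adj F j i ∧ (toℕ j <ᵇ toℕ i))
orientations F i j rewrite adjSym F j i with <-cmp (toℕ i) (toℕ j)
... | tri< i<j _ j≮i rewrite <ᵇ-true i<j | <ᵇ-false j≮i = forward (adj F i j)
  where
  forward : ∀ b → 𝟙 b ≡ 𝟙 (b ∧ true) + 𝟙 (b ∧ false)
  forward true  = refl
  forward false = refl
... | tri> i≮j _ j<i rewrite <ᵇ-false i≮j | <ᵇ-true j<i = backward (adj F i j)
  where
  backward : ∀ b → 𝟙 b ≡ 𝟙 (b ∧ false) + 𝟙 (b ∧ true)
  backward true  = refl
  backward false = refl
... | tri≈ _ i≡j _ with toℕ-injective i≡j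
...   | refl rewrite adjIrr F i = refl

arcCount≡2∣E∣ : ∀ F → arcCount F ≡ ∣E∣ F + ∣E∣ F
arcCount≡2∣E∣ F = begin
  arcCount F
    ≡⟨ ∑-cong (allFin m) (λ i → trans (∑-cong (allFin m) (orientations F i)) (∑-+ (allFin m) _ _)) ⟩
  ∑Fin m (λ i → ∑Fin m (λ j → forward i j) + ∑Fin m (λ j → forward j i))
    ≡⟨ ∑-+ (allFin m) _ _ ⟩
  ∣E∣ F + ∑Fin m (λ i → ∑Fin m (λ j → forward j i))
    ≡⟨ cong (∣E∣ F +_) (∑-swap (allFin m) (allFin m) (λ i j → forward j i)) ⟩
  ∣E∣ F + ∣E∣ F ∎
  where
  open ≡-Reasoning
  m : ℕ
  m = n F
  forward : Fin m → Fin m → ℕ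
  forward i j = 𝟙 (adj F i j ∧ (toℕ i <ᵇ toℕ j))

-- In K₂ □ H the two copies of H contribute arcCount H each, and the
-- matching between them 2 · |V(H)| arcs.
arcCount-K₂□ : ∀ H → arcCount (K₂ □ H) ≡ 2 * arcCount H + 2 * n H
arcCount-K₂□ H = begin
  arcCount (K₂ □ H)
    ≡⟨ by-blocks ⟩
  ∑Fin 2 (λ a → ∑Fin 2 (λ b → block a b))
    ≡⟨ cong₂ (λ p q → arcCount H + (p + 0) + (q + (arcCount H + 0) + 0)) matching matching ⟩
  arcCount H + (v + 0) + (v + (arcCount H + 0) + 0)
    ≡⟨ tidy (arcCount H) v ⟩
  2 * arcCount H + 2 * v ∎
  where
  open ≡-Reasoning
  v : ℕ
  v = n H
  block : Fin 2 → Fin 2 → ℕ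
  block a b = ∑Fin v (λ r → ∑Fin v (λ s → 𝟙 (cartAdj K₂ H a r b s)))
  by-blocks : arcCount (K₂ □ H) ≡ ∑Fin 2 (λ a → ∑Fin 2 (λ b → block a b))
  by-blocks =
    trans (∑-cong (allFin (2 * v)) (λ x → ∑Fin-combine 2 v _))
    (trans (∑Fin-combine 2 v _)
    (∑-cong (allFin 2) (λ a →
      trans (∑-cong (allFin v) (λ r → ∑-cong (allFin 2) (λ b → ∑-cong (allFin v) (λ s →
              cong 𝟙 (□-adj-combine K₂ H a r b s)))))
            (∑-swap (allFin v) (allFin 2) (λ r b → ∑Fin v (λ s → 𝟙 (cartAdj K₂ H a r b s)))))))
  matching : ∑Fin v (λ r → ∑Fin v (λ s → 𝟙 (eqᵇ r s ∨ false))) ≡ v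
  matching = trans (∑-cong (allFin v) (λ r → trans (∑-cong (allFin v) (λ s → cong 𝟙 (∨-identityʳ (eqᵇ r s))))
                                                  (∑Fin-δ v r)))
                   (∑Fin-one v)
  tidy : ∀ a v → a + (v + 0) + (v + (a + 0) + 0) ≡ 2 * a + 2 * v
  tidy = solve-∀

∣E∣-K₂□ : ∀ H → ∣E∣ (K₂ □ H) ≡ 2 * ∣E∣ H + n H
∣E∣-K₂□ H = *-cancelˡ-≡ _ _ 2 (begin
  2 * ∣E∣ (K₂ □ H)               ≡⟨ double (∣E∣ (K₂ □ H)) ⟩
  ∣E∣ (K₂ □ H) + ∣E∣ (K₂ □ H)     ≡⟨ arcCount≡2∣E∣ (K₂ □ H) ⟨
  arcCount (K₂ □ H)              ≡⟨ arcCount-K₂□ H ⟩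
  2 * arcCount H + 2 * n H       ≡⟨ cong (λ c → 2 * c + 2 * n H) (arcCount≡2∣E∣ H) ⟩
  2 * (∣E∣ H + ∣E∣ H) + 2 * n H   ≡⟨ regroup (∣E∣ H) (n H) ⟩
  2 * (2 * ∣E∣ H + n H)          ∎)
  where
  open ≡-Reasoning
  double : ∀ x → 2 * x ≡ x + x
  double = solve-∀
  regroup : ∀ e v → 2 * (e + e) + 2 * v ≡ 2 * (2 * e + v)
  regroup = solve-∀

hom-K₂ : ∀ G → hom K₂ G ≡ arcCount G
hom-K₂ G = ∑-cong (allFin (n G)) (λ a → ∑-cong (allFin (n G)) (λ b → cong 𝟙 (isHom-K₂ a b)))
  where
  isHom-K₂ : ∀ a b → isHom K₂ G (a ∷ᶠ (b ∷ᶠ λ ())) ≡ adj G a b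
  isHom-K₂ a b rewrite adjSym G b a with adj G a b
  ... | true  = refl
  ... | false = refl

hom-empty : ∀ F G → n F ≡ 0 → hom F G ≡ 1
hom-empty record { n = zero } G refl = refl

module ArcGraph (G : Graph) where

  N : ℕ
  N = n G

  Pair : Set
  Pair = Fin N × Fin N

  isArc : Pair → Bool
  isArc p = adj G (proj₁ p) (proj₂ p)

  bothAdj : Pair → Pair → Bool
  bothAdj p q = adj G (proj₁ p) (proj₁ q) ∧ adj G (proj₂ p) (proj₂ q)

  allPairs : List Pair
  allPairs = cartesianProduct (allFin N) (allFin N)

  arcs : List Pair
  arcs = filterᵇ isArc allPairs

  arcGraph : Graph
  arcGraph = record
    { n      = length arcs
    ; adj    = λ p q → bothAdj (lookup arcs p) (lookup arcs q)
    ; adjSym = λ p q → cong₂ _∧_ (adjSym G _ _) (adjSym G _ _)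
    ; adjIrr = λ p → cong (_∧ adj G (proj₂ (lookup arcs p)) (proj₂ (lookup arcs p)))
                          (adjIrr G (proj₁ (lookup arcs p)))
    }

  ∣V∣-arcGraph : n arcGraph ≡ hom K₂ G
  ∣V∣-arcGraph = begin
    length arcs                                                ≡⟨ ∑-one arcs ⟨
    ∑ arcs (λ _ → 1)                                           ≡⟨ ∑-filter isArc allPairs (λ _ → 1) ⟩
    ∑ allPairs (λ p → 𝟙 (isArc p) * 1) ≡⟨ ∑-cartesianProduct (allFin N) (allFin N) _ ⟩
    ∑Fin N (λ a → ∑Fin N (λ b → 𝟙 (adj G a b) * 1))            ≡⟨ ∑-cong (allFin N) (λ a → ∑-cong (allFin N) (λ b → *-identityʳ _)) ⟩
    arcCount G                                                 ≡⟨ hom-K₂ G ⟨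
    hom K₂ G                                                   ∎
    where open ≡-Reasoning

  pairWeight : (F : Graph) → (Fin (n F) → Fin N) → (Fin (n F) → Fin N) → ℕ
  pairWeight F f₁ f₂ = 𝟙 (allᵇ (n F) (λ i → isArc (f₁ i , f₂ i)))
                     * 𝟙 (isHomᴿ (n F) (adj F) bothAdj (λ i → f₁ i , f₂ i))

  hom-arcGraph : ∀ F → hom F arcGraph ≡ ∑Maps (n F) (allFin N) (λ f₁ → ∑Maps (n F) (allFin N) (pairWeight F f₁))
  hom-arcGraph F = begin
    hom F arcGraph                                         ≡⟨ countFun≡∑Maps k (length arcs) (isHom F arcGraph) ⟩
    ∑Maps k (allFin (length arcs)) (w ∘ (lookup arcs ∘_))  ≡⟨ ∑Maps-map k (allFin (length arcs)) (lookup arcs) w w-ext ⟨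
    ∑Maps k (map (lookup arcs) (allFin (length arcs))) w   ≡⟨ cong (λ xs → ∑Maps k xs w) lookup-arcs ⟩
    ∑Maps k arcs w                                         ≡⟨ ∑Maps-filter k isArc allPairs w ⟩
    ∑Maps k allPairs (λ g → 𝟙 (allᵇ k (isArc ∘ g)) * w g)
      ≡⟨ ∑Maps-cartesianProduct k (allFin N) (allFin N) _ weight-ext ⟩
    ∑Maps k (allFin N) (λ f₁ → ∑Maps k (allFin N) (pairWeight F f₁)) ∎
    where
    open ≡-Reasoning
    k : ℕ
    k = n F
    w : (Fin k → Pair) → ℕ
    w g = 𝟙 (isHomᴿ k (adj F) bothAdj g)
    w-ext : Extensional w
    w-ext f g f≗g = cong 𝟙 (isHomᴿ-cong k (adj F) bothAdj f g f≗g)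
    weight-ext : Extensional (λ g → 𝟙 (allᵇ k (isArc ∘ g)) * w g)
    weight-ext f g f≗g = cong₂ _*_ (cong 𝟙 (allᵇ-cong k (λ i → cong isArc (f≗g i)))) (w-ext f g f≗g)
    lookup-arcs : map (lookup arcs) (allFin (length arcs)) ≡ arcs
    lookup-arcs = trans (map-tabulate id (lookup arcs)) (tabulate-lookup arcs)

module K₂□Homomorphisms (G H : Graph) where
  open ArcGraph G

  v : ℕ
  v = n H

  -- V(K₂ □ H) = Fin (2 * v) = Fin (v + (v + 0)): vertex (c, r) is combine c r,
  -- so a map on it is f₁ on copy 0 of H, f₂ on copy 1 (f₃ covers Fin 0).
  module _ (f₁ f₂ : Fin v → Fin N) (f₃ : Fin 0 → Fin N) where

    glued : Fin (2 * v) → Fin N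
    glued = f₁ ++ᶠ (f₂ ++ᶠ f₃)

    glued-copy₀ : ∀ r → glued (combine {2} zero r) ≡ f₁ r
    glued-copy₀ r rewrite splitAt-↑ˡ v r (1 * v) = refl

    glued-copy₁ : ∀ r → glued (combine {2} (suc zero) r) ≡ f₂ r
    glued-copy₁ r rewrite splitAt-↑ʳ v (v + 0) (combine {1} zero r) | splitAt-↑ˡ v r (0 * v) = refl

    pair : Fin v → Pair
    pair i = f₁ i , f₂ i

    -- Edges of K₂ □ H are edges inside a copy of H (giving bothAdj) and the
    -- matching edges (0, r) — (1, r) (giving the arcs (f₁ r, f₂ r)).
    glued-hom⇒ : isHom (K₂ □ H) G glued ≡ true →
      (allᵇ v (isArc ∘ pair) ≡ true) × (isHomᴿ v (adj H) bothAdj pair ≡ true)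
    glued-hom⇒ hom = allᵇ-intro v _ pair-isArc , isHomᴿ-intro v (adj H) bothAdj pair pair-bothAdj
      where
      edge : ∀ a r b s → cartAdj K₂ H a r b s ≡ true → adj G (glued (combine a r)) (glued (combine b s)) ≡ true
      edge a r b s e = isHomᴿ-elim (2 * v) (adj (K₂ □ H)) (adj G) glued hom _ _ (trans (□-adj-combine K₂ H a r b s) e)
      pair-isArc : ∀ r → isArc (pair r) ≡ true
      pair-isArc r = subst₂ (λ x y → adj G x y ≡ true) (glued-copy₀ r) (glued-copy₁ r)
        (edge zero r (suc zero) r (cong (_∨ false) (eqᵇ-refl r)))
      pair-bothAdj : ∀ i j → adj H i j ≡ true → bothAdj (pair i) (pair j) ≡ true
      pair-bothAdj i j ij = ∧-intro
        (subst₂ (λ x y → adj G x y ≡ true) (glued-copy₀ i) (glued-copy₀ j) (edge zero i zero j ij))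
        (subst₂ (λ x y → adj G x y ≡ true) (glued-copy₁ i) (glued-copy₁ j) (edge (suc zero) i (suc zero) j ij))

    glued-hom⇐ : allᵇ v (isArc ∘ pair) ≡ true → isHomᴿ v (adj H) bothAdj pair ≡ true →
      isHom (K₂ □ H) G glued ≡ true
    glued-hom⇐ all-arcs pair-hom = isHomᴿ-intro (2 * v) (adj (K₂ □ H)) (adj G) glued edge
      where
      arc : ∀ r → adj G (f₁ r) (f₂ r) ≡ true
      arc = allᵇ-elim v _ all-arcs
      both : ∀ r s → adj H r s ≡ true → bothAdj (pair r) (pair s) ≡ true
      both = isHomᴿ-elim v (adj H) bothAdj pair pair-hom
      edge-combine : ∀ a r b s → cartAdj K₂ H a r b s ≡ true →
        adj G (glued (combine a r)) (glued (combine b s)) ≡ true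
      edge-combine zero r zero s e rewrite glued-copy₀ r | glued-copy₀ s = proj₁ (∧-elim (both r s e))
      edge-combine (suc zero) r (suc zero) s e rewrite glued-copy₁ r | glued-copy₁ s = proj₂ (∧-elim (both r s e))
      edge-combine zero r (suc zero) s e
        rewrite glued-copy₀ r | glued-copy₁ s | eqᵇ-true r s (trans (sym (∨-identityʳ (eqᵇ r s))) e) = arc s
      edge-combine (suc zero) r zero s e
        rewrite glued-copy₁ r | glued-copy₀ s | eqᵇ-true r s (trans (sym (∨-identityʳ (eqᵇ r s))) e) =
          trans (adjSym G (f₂ s) (f₁ s)) (arc s)
      edge : ∀ x y → adj (K₂ □ H) x y ≡ true → adj G (glued x) (glued y) ≡ true
      edge x y e = subst₂ (λ p q → adj G (glued p) (glued q) ≡ true)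
        (combine-remQuot {2} v x) (combine-remQuot {2} v y)
        (edge-combine (proj₁ (remQuot v x)) (proj₂ (remQuot v x)) (proj₁ (remQuot v y)) (proj₂ (remQuot v y)) e)

    glued-weight : 𝟙 (isHom (K₂ □ H) G glued) ≡ pairWeight H f₁ f₂
    glued-weight = trans
      (cong 𝟙 (≡-by-truth
        (λ hom → let (all-arcs , homᴿ) = glued-hom⇒ hom in ∧-intro all-arcs homᴿ)
        (λ both → let (all-arcs , homᴿ) = ∧-elim both in glued-hom⇐ all-arcs homᴿ)))
      (𝟙-∧ (allᵇ v (isArc ∘ pair)) (isHomᴿ v (adj H) bothAdj pair))

  hom-K₂□ : hom (K₂ □ H) G ≡ hom H arcGraph
  hom-K₂□ = begin
    hom (K₂ □ H) G
      ≡⟨ countFun≡∑Maps (2 * v) N (isHom (K₂ □ H) G) ⟩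
    ∑Maps (2 * v) (allFin N) weight
      ≡⟨ ∑Maps-++ v (v + 0) (allFin N) weight weight-ext ⟩
    ∑Maps v (allFin N) (λ f₁ → ∑Maps (v + 0) (allFin N) (λ g → weight (f₁ ++ᶠ g)))
      ≡⟨ ∑Maps-cong v (allFin N) (λ f₁ → ∑Maps-++ v 0 (allFin N) _
           (λ g g′ g≗g′ → weight-ext _ _ (++ᶠ-congʳ f₁ g g′ g≗g′))) ⟩
    ∑Maps v (allFin N) (λ f₁ → ∑Maps v (allFin N) (λ f₂ → weight (glued f₁ f₂ (λ ()))))
      ≡⟨ ∑Maps-cong v (allFin N) (λ f₁ → ∑Maps-cong v (allFin N) (λ f₂ → glued-weight f₁ f₂ (λ ()))) ⟩
    ∑Maps v (allFin N) (λ f₁ → ∑Maps v (allFin N) (pairWeight H f₁))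
      ≡⟨ hom-arcGraph H ⟨
    hom H arcGraph ∎
    where
    open ≡-Reasoning
    weight : (Fin (2 * v) → Fin N) → ℕ
    weight f = 𝟙 (isHom (K₂ □ H) G f)
    weight-ext : Extensional weight
    weight-ext f f′ f≗f′ = cong 𝟙 (isHomᴿ-cong (2 * v) (adj (K₂ □ H)) (adj G) f f′ f≗f′)

-- hom(K₂, G⁽²⁾) counts closed 4-walks a₀ b₀ b₁ a₁ of G; by Cauchy–Schwarz
-- it is at least D⁴ / N⁴, where D = hom(K₂, G) and N = |V(G)|.
module FourCycles (G : Graph) where
  open ArcGraph G

  α : Fin N → Fin N → ℕ
  α x y = 𝟙 (adj G x y)

  closedWalk : Fin N → Fin N → Fin N → Fin N → ℕ
  closedWalk a₀ a₁ b₀ b₁ = α a₀ b₀ * α a₁ b₁ * α a₀ a₁ * α b₀ b₁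

  hom-K₂-arcGraph : hom K₂ arcGraph ≡
    ∑Fin N (λ a₀ → ∑Fin N (λ a₁ → ∑Fin N (λ b₀ → ∑Fin N (λ b₁ → closedWalk a₀ a₁ b₀ b₁))))
  hom-K₂-arcGraph = trans (hom-arcGraph K₂)
    (∑-cong (allFin N) (λ a₀ → ∑-cong (allFin N) (λ a₁ → ∑-cong (allFin N) (λ b₀ → ∑-cong (allFin N) (λ b₁ →
      weight a₀ a₁ b₀ b₁)))))
    where
    weight : ∀ a₀ a₁ b₀ b₁ → pairWeight K₂ (a₀ ∷ᶠ (a₁ ∷ᶠ λ ())) (b₀ ∷ᶠ (b₁ ∷ᶠ λ ())) ≡ closedWalk a₀ a₁ b₀ b₁
    weight a₀ a₁ b₀ b₁ rewrite adjSym G a₁ a₀ | adjSym G b₁ b₀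
      with adj G a₀ b₀ | adj G a₁ b₁ | adj G a₀ a₁ | adj G b₀ b₁
    ... | true  | true  | true  | true  = refl
    ... | true  | true  | true  | false = refl
    ... | true  | true  | false | _     = refl
    ... | true  | false | _     | _     = refl
    ... | false | _     | _     | _     = refl

  codegree : Fin N → Fin N → ℕ
  codegree u w = ∑Fin N (λ m → α u m * α m w)

  degree : Fin N → ℕ
  degree m = ∑Fin N (α m)

  -- Grouping a closed 4-walk by its opposite corners a₀, b₁.
  walks-codegree : hom K₂ arcGraph ≡ ∑Fin N (λ u → ∑Fin N (λ w → codegree u w * codegree u w))
  walks-codegree = begin
    hom K₂ arcGraph
      ≡⟨ hom-K₂-arcGraph ⟩
    ∑Fin N (λ a₀ → ∑Fin N (λ a₁ → ∑Fin N (λ b₀ → ∑Fin N (λ b₁ → closedWalk a₀ a₁ b₀ b₁))))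
      ≡⟨ ∑-cong (allFin N) reorder ⟩
    ∑Fin N (λ a₀ → ∑Fin N (λ b₁ → ∑Fin N (λ b₀ → ∑Fin N (λ a₁ → closedWalk a₀ a₁ b₀ b₁))))
      ≡⟨ ∑-cong (allFin N) (λ a₀ → ∑-cong (allFin N) (factor a₀)) ⟩
    ∑Fin N (λ u → ∑Fin N (λ w → codegree u w * codegree u w)) ∎
    where
    open ≡-Reasoning
    reorder : ∀ a₀ → ∑Fin N (λ a₁ → ∑Fin N (λ b₀ → ∑Fin N (λ b₁ → closedWalk a₀ a₁ b₀ b₁)))
                   ≡ ∑Fin N (λ b₁ → ∑Fin N (λ b₀ → ∑Fin N (λ a₁ → closedWalk a₀ a₁ b₀ b₁)))
    reorder a₀ =
      trans (∑-cong (allFin N) (λ a₁ → ∑-swap (allFin N) (allFin N) (closedWalk a₀ a₁)))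
      (trans (∑-swap (allFin N) (allFin N) (λ a₁ b₁ → ∑Fin N (λ b₀ → closedWalk a₀ a₁ b₀ b₁)))
        (∑-cong (allFin N) (λ b₁ → ∑-swap (allFin N) (allFin N) (λ a₁ b₀ → closedWalk a₀ a₁ b₀ b₁))))
    regroup : ∀ p q r s → p * q * r * s ≡ p * s * (r * q)
    regroup = solve-∀
    factor : ∀ a₀ b₁ → ∑Fin N (λ b₀ → ∑Fin N (λ a₁ → closedWalk a₀ a₁ b₀ b₁)) ≡ codegree a₀ b₁ * codegree a₀ b₁
    factor a₀ b₁ = trans
      (∑-cong (allFin N) (λ b₀ → ∑-cong (allFin N) (λ a₁ → regroup (α a₀ b₀) (α a₁ b₁) (α a₀ a₁) (α b₀ b₁))))
      (sym (∑-product (allFin N) (allFin N) (λ b₀ → α a₀ b₀ * α b₀ b₁) (λ a₁ → α a₀ a₁ * α a₁ b₁)))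

  -- Paths of length two, counted by endpoints or by midpoint.
  codegree-sum : ∑Fin N (λ u → ∑Fin N (codegree u)) ≡ ∑Fin N (λ m → degree m * degree m)
  codegree-sum =
    trans (∑-cong (allFin N) (λ u → trans (∑-swap (allFin N) (allFin N) (λ w m → α u m * α m w))
                                   (∑-cong (allFin N) (λ m → sym (∑-*ˡ (allFin N) (α u m) (α m))))))
    (trans (∑-swap (allFin N) (allFin N) (λ u m → α u m * degree m))
    (∑-cong (allFin N) (λ m → trans (sym (∑-*ʳ (allFin N) (degree m) (λ u → α u m)))
      (cong (_* degree m) (∑-cong (allFin N) (λ u → cong 𝟙 (adjSym G u m)))))))

  -- D² ≤ N · ∑ deg² = N · ∑ codeg  and  (∑ codeg)² ≤ N² · ∑ codeg², hence D⁴ ≤ N⁴ · hom(K₂, G⁽²⁾).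
  four-cycle-bound : hom K₂ G ^ 4 ≤ N ^ 4 * hom K₂ arcGraph
  four-cycle-bound = begin
    D ^ 4                 ≡⟨ fourth D ⟨
    D * D * (D * D)       ≤⟨ *-mono-≤ D²-bound D²-bound ⟩
    N * S * (N * S)       ≡⟨ regroup N S ⟩
    N * N * (S * S)       ≤⟨ *-monoʳ-≤ (N * N) S²-bound ⟩
    N * N * (N * (N * C)) ≡⟨ fourth-times N C ⟩
    N ^ 4 * C             ∎
    where
    open ≤-Reasoning
    C D S : ℕ
    C = hom K₂ arcGraph
    D = hom K₂ G
    S = ∑Fin N (λ u → ∑Fin N (codegree u))
    D²-bound : D * D ≤ N * S
    D²-bound = subst₂ (λ x y → x * x ≤ N * y) (sym (hom-K₂ G)) (sym codegree-sum) (cauchy-schwarz-Fin N degree)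
    S²-bound : S * S ≤ N * (N * C)
    S²-bound = ≤-trans (cauchy-schwarz-Fin N (λ u → ∑Fin N (codegree u)))
      (subst (λ z → N * ∑Fin N (λ u → ∑Fin N (codegree u) * ∑Fin N (codegree u)) ≤ N * z)
        (trans (sym (∑-*ˡ (allFin N) N _)) (cong (N *_) (sym walks-codegree)))
        (*-monoʳ-≤ N (∑-mono (allFin N) (λ u → cauchy-schwarz-Fin N (codegree u)))))
    -- d ^ 4 unfolds to d * (d * (d * (d * 1))), which the ring solver handles.
    fourth : ∀ d → d * d * (d * d) ≡ d * (d * (d * (d * 1)))
    fourth = solve-∀
    fourth-times : ∀ n c → n * n * (n * (n * c)) ≡ n * (n * (n * (n * 1))) * c
    fourth-times = solve-∀
    regroup : ∀ n s → n * s * (n * s) ≡ n * n * (s * s)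
    regroup = solve-∀

*-^-distribʳ : ∀ x y e → (x * y) ^ e ≡ x ^ e * y ^ e
*-^-distribʳ x y zero    = refl
*-^-distribʳ x y (suc e) = trans (cong (x * y *_) (*-^-distribʳ x y e)) (*-interchange x y (x ^ e) (y ^ e))

-- With D = hom(K₂,G), N = |V(G)|, C = hom(K₂,G⁽²⁾),
-- X = hom(H,G⁽²⁾), e = |E(H)|, v = |V(H)|: Sidorenko's inequality for H in G⁽²⁾
-- and D⁴ ≤ N⁴C give Sidorenko's inequality for K₂ □ H in G.  For D ≥ 1,
--   D^(2e) · D^(2e+v) = (D⁴)^e · D^v ≤ N^(4e) · C^e · D^v ≤ N^(4e) · X · D^(2e);
-- for D = 0 the left side vanishes unless e = v = 0, when X = hom(H, ·) = 1.
sidorenko-arithmetic : ∀ D N C X e v →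
  (1 ≤ D → C ^ e * D ^ v ≤ X * D ^ (2 * e)) →
  D ^ 4 ≤ N ^ 4 * C →
  (v ≡ 0 → X ≡ 1) →
  D ^ (2 * e + v) * N ^ (2 * v) ≤ X * N ^ (2 * (2 * e + v))
sidorenko-arithmetic zero N C X e v _ _ X≡1 with 2 * e + v in 2e+v≡
... | suc _ = z≤n
... | zero with m+n≡0⇒n≡0 (2 * e) 2e+v≡
...   | refl rewrite X≡1 refl = ≤-refl
sidorenko-arithmetic D@(suc _) N C X e v sidorenko four-cycles _ = begin
  D ^ (2 * e + v) * N ^ (2 * v)   ≤⟨ *-monoˡ-≤ (N ^ (2 * v)) core ⟩
  N ^ (4 * e) * X * N ^ (2 * v)   ≡⟨ collect ⟩
  X * N ^ (2 * (2 * e + v))       ∎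
  where
  open ≤-Reasoning
  exponents : ∀ e v → 2 * e + (2 * e + v) ≡ 4 * e + v
  exponents = solve-∀
  split : D ^ (2 * e) * D ^ (2 * e + v) ≡ (D ^ 4) ^ e * D ^ v
  split = begin-equality
    D ^ (2 * e) * D ^ (2 * e + v)   ≡⟨ ^-distribˡ-+-* D (2 * e) (2 * e + v) ⟨
    D ^ (2 * e + (2 * e + v))       ≡⟨ cong (D ^_) (exponents e v) ⟩
    D ^ (4 * e + v)                 ≡⟨ ^-distribˡ-+-* D (4 * e) v ⟩
    D ^ (4 * e) * D ^ v             ≡⟨ cong (_* D ^ v) (^-*-assoc D 4 e) ⟨
    (D ^ 4) ^ e * D ^ v             ∎
  rotate : ∀ a b c → a * (b * c) ≡ c * (a * b)
  rotate = solve-∀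
  core : D ^ (2 * e + v) ≤ N ^ (4 * e) * X
  core = *-cancelˡ-≤ (D ^ (2 * e)) {{m^n≢0 D (2 * e)}} (begin
    D ^ (2 * e) * D ^ (2 * e + v)     ≡⟨ split ⟩
    (D ^ 4) ^ e * D ^ v               ≤⟨ *-monoˡ-≤ (D ^ v) (^-monoˡ-≤ e four-cycles) ⟩
    (N ^ 4 * C) ^ e * D ^ v           ≡⟨ cong (_* D ^ v) (*-^-distribʳ (N ^ 4) C e) ⟩
    (N ^ 4) ^ e * C ^ e * D ^ v       ≡⟨ cong (λ p → p * C ^ e * D ^ v) (^-*-assoc N 4 e) ⟩
    N ^ (4 * e) * C ^ e * D ^ v       ≡⟨ *-assoc (N ^ (4 * e)) (C ^ e) (D ^ v) ⟩
    N ^ (4 * e) * (C ^ e * D ^ v)     ≤⟨ *-monoʳ-≤ (N ^ (4 * e)) (sidorenko (s≤s z≤n)) ⟩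
    N ^ (4 * e) * (X * D ^ (2 * e))   ≡⟨ rotate (N ^ (4 * e)) X (D ^ (2 * e)) ⟩
    D ^ (2 * e) * (N ^ (4 * e) * X)   ∎)
  collect : N ^ (4 * e) * X * N ^ (2 * v) ≡ X * N ^ (2 * (2 * e + v))
  collect = begin-equality
    N ^ (4 * e) * X * N ^ (2 * v)     ≡⟨ cong (_* N ^ (2 * v)) (*-comm (N ^ (4 * e)) X) ⟩
    X * N ^ (4 * e) * N ^ (2 * v)     ≡⟨ *-assoc X (N ^ (4 * e)) (N ^ (2 * v)) ⟩
    X * (N ^ (4 * e) * N ^ (2 * v))   ≡⟨ cong (X *_) (^-distribˡ-+-* N (4 * e) (2 * v)) ⟨
    X * N ^ (4 * e + 2 * v)           ≡⟨ cong (λ k → X * N ^ k) (double e v) ⟩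
    X * N ^ (2 * (2 * e + v))         ∎
    where
    double : ∀ e v → 4 * e + 2 * v ≡ 2 * (2 * e + v)
    double = solve-∀

theorem3p3 : (H : Graph) → IsBipartite H → Sidorenko H → Sidorenko (K₂ □ H)
theorem3p3 H _ sidorenko-H G _ rewrite ∣E∣-K₂□ H | K₂□Homomorphisms.hom-K₂□ G H =
  sidorenko-arithmetic (hom K₂ G) (n G) (hom K₂ arcGraph) (hom H arcGraph) (∣E∣ H) (n H)
    sidorenko-in-arcGraph (FourCycles.four-cycle-bound G) (hom-empty H arcGraph)
  where
  open ArcGraph G
  -- Sidorenko's property of H in the arc graph, whose order is hom(K₂, G).
  sidorenko-in-arcGraph : 1 ≤ hom K₂ G →
    hom K₂ arcGraph ^ ∣E∣ H * hom K₂ G ^ n H ≤ hom H arcGraph * hom K₂ G ^ (2 * ∣E∣ H)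
  sidorenko-in-arcGraph = subst
    (λ D → 1 ≤ D → hom K₂ arcGraph ^ ∣E∣ H * D ^ n H ≤ hom H arcGraph * D ^ (2 * ∣E∣ H))
    ∣V∣-arcGraph (sidorenko-H arcGraph)
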